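{- For any $m,k,\rho\in\mathbb{N}$ and any distribution $\mathcal{D}$ over $[k]^m$: if $\mathcal{D}$ is $\rho$-dispersed, then $\mathcal{D}^{(m-1)}$ is $\rho$-dispersed.
   Context: A distribution $\mathcal{D}$ over $[k]^m$ is $\rho$-dispersed if for every $j\in[m]$ and every $(i_1,\dots,i_m)\in[k]^m$, $\mathcal{D}(i_1,\dots,i_m)\le\rho\cdot\mathbb{E}_{t\sim U_k}[\mathcal{D}(i_1,\dots,i_{j-1},t,i_{j+1},\dots,i_m)]$, where $U_k$ is uniform on $[k]$ (the same condition applies to distributions over $[k]^{m-1}$ with $m-1$ coordinates). The marginal $\mathcal{D}^{(m-1)}$ is the distribution over $[k]^{m-1}$ given by $\mathcal{D}^{(m-1)}(i_1,\dots,i_{m-1})=\sum_{t\in[k]}\mathcal{D}(i_1,\dots,i_{m-1},t)$.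
   Formalization: The distribution $\mathcal{D}$ over $[k]^m$ takes only rational values. -}

module Defs where

open import Data.Nat using (ℕ; zero; suc)
open import Data.Integer using (+_)
open import Data.Fin using (Fin; zero; suc)
open import Data.Vec using (Vec; []; _∷_; _∷ʳ_; _[_]≔_)
open import Data.Rational using (ℚ; 0ℚ; 1ℚ; _+_; _*_; _/_; _≤_)

sumFin : ∀ k → (Fin k → ℚ) → ℚ
sumFin zero    f = 0ℚ
sumFin (suc k) f = f zero + sumFin k (λ i → f (suc i))

-- Expectation of f(t) for t uniform on [k]  ( (1/k) Σ_t f t ).
-- (For k = 0 there is no uniform distribution; the value is irrelevant,
--  since [0]^m is empty for m ≥ 1; we set it to 0.)
𝔼U : ∀ k → (Fin k → ℚ) → ℚ
𝔼U zero    f = 0ℚ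
𝔼U (suc k) f = sumFin (suc k) f * (+ 1 / suc k)

sumAll : ∀ k m → (Vec (Fin k) m → ℚ) → ℚ
sumAll k zero    D = D []
sumAll k (suc m) D = sumFin k (λ t → sumAll k m (λ v → D (t ∷ v)))

IsDistribution : ∀ k m → (Vec (Fin k) m → ℚ) → Set
IsDistribution k m D =
  (∀ (i : Vec (Fin k) m) → 0ℚ ≤ D i) × (sumAll k m D ≡ 1ℚ)
  where
  open import Data.Product using (_×_)
  open import Relation.Binary.PropositionalEquality using (_≡_)

Dispersed : ∀ k m → ℕ → (Vec (Fin k) m → ℚ) → Set
Dispersed k m ρ D =
  ∀ (j : Fin m) (i : Vec (Fin k) m) →
    D i ≤ (+ ρ / 1) * 𝔼U k (λ t → D (i [ j ]≔ t))

marginal : ∀ k m → (Vec (Fin k) (suc m) → ℚ) → (Vec (Fin k) m → ℚ)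
marginal k m D i = sumFin k (λ t → D (i ∷ʳ t))

{-# OPTIONS --safe #-}
module Submission where

-- Summing the dispersion inequality for coordinate j of D over the last
-- coordinate t gives the one for the marginal: the updated point
-- (i ∷ʳ t)[j] ≔ s is ((i[j] ≔ s) ∷ʳ t), and both the scalar ρ and the
-- uniform expectation commute with the sum over t.

open import Defs
open import Data.Nat using (ℕ; zero; suc)
open import Data.Fin using (Fin; zero; suc; inject₁)
open import Data.Vec using (Vec; _∷_; _∷ʳ_; _[_]≔_)
open import Data.Rational using (ℚ; 0ℚ; _+_; _*_; _≤_; _/_)
open import Data.Integer using (+_)
open import Data.Rational.Properties using (+-*-ring; +-mono-≤; ≤-refl; module ≤-Reasoning)
open import Algebra.Bundles using (Ring)
open import Algebra.Properties.Semiring.Sum (Ring.semiring +-*-ring)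
  using (sum; sum-cong-≗; ∑-comm; *-distribˡ-sum; *-distribʳ-sum; sum-replicate-zero)
open import Relation.Binary.PropositionalEquality using (_≡_; refl; sym; trans; cong; cong₂; module ≡-Reasoning)

sumFin≡sum : ∀ k (f : Fin k → ℚ) → sumFin k f ≡ sum f
sumFin≡sum zero    f = refl
sumFin≡sum (suc k) f = cong (_+_ (f zero)) (sumFin≡sum k (λ t → f (suc t)))

sumFin-cong : ∀ k {f g : Fin k → ℚ} → (∀ t → f t ≡ g t) → sumFin k f ≡ sumFin k g
sumFin-cong zero    f≗g = refl
sumFin-cong (suc k) f≗g = cong₂ _+_ (f≗g zero) (sumFin-cong k (λ t → f≗g (suc t)))

𝔼U-cong : ∀ k {f g : Fin k → ℚ} → (∀ t → f t ≡ g t) → 𝔼U k f ≡ 𝔼U k g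
𝔼U-cong zero    f≗g = refl
𝔼U-cong (suc k) f≗g = cong (_* (+ 1 / suc k)) (sumFin-cong (suc k) f≗g)

sumFin-mono-≤ : ∀ k {f g : Fin k → ℚ} → (∀ t → f t ≤ g t) → sumFin k f ≤ sumFin k g
sumFin-mono-≤ zero    f≤g = ≤-refl
sumFin-mono-≤ (suc k) f≤g = +-mono-≤ (f≤g zero) (sumFin-mono-≤ k (λ t → f≤g (suc t)))

sumFin-const-0 : ∀ n → sumFin n (λ _ → 0ℚ) ≡ 0ℚ
sumFin-const-0 n = trans (sumFin≡sum n _) (sum-replicate-zero n)

*-distribˡ-sumFin : ∀ k c (f : Fin k → ℚ) → c * sumFin k f ≡ sumFin k (λ t → c * f t)
*-distribˡ-sumFin k c f = begin
  c * sumFin k f            ≡⟨ cong (c *_) (sumFin≡sum k f) ⟩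
  c * sum f                 ≡⟨ *-distribˡ-sum c f ⟩
  sum (λ t → c * f t)       ≡⟨ sym (sumFin≡sum k _) ⟩
  sumFin k (λ t → c * f t)  ∎
  where open ≡-Reasoning

*-distribʳ-sumFin : ∀ k c (f : Fin k → ℚ) → sumFin k f * c ≡ sumFin k (λ t → f t * c)
*-distribʳ-sumFin k c f = begin
  sumFin k f * c            ≡⟨ cong (_* c) (sumFin≡sum k f) ⟩
  sum f * c                 ≡⟨ *-distribʳ-sum c f ⟩
  sum (λ t → f t * c)       ≡⟨ sym (sumFin≡sum k _) ⟩
  sumFin k (λ t → f t * c)  ∎
  where open ≡-Reasoning

sumFin-comm : ∀ m n (f : Fin m → Fin n → ℚ) →
  sumFin m (λ s → sumFin n (f s)) ≡ sumFin n (λ t → sumFin m (λ s → f s t))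
sumFin-comm m n f = begin
  sumFin m (λ s → sumFin n (f s))          ≡⟨ sumFin≡sum m _ ⟩
  sum (λ s → sumFin n (f s))               ≡⟨ sum-cong-≗ (λ s → sumFin≡sum n (f s)) ⟩
  sum (λ s → sum (f s))                    ≡⟨ ∑-comm f ⟩
  sum (λ t → sum (λ s → f s t))            ≡⟨ sum-cong-≗ (λ t → sym (sumFin≡sum m (λ s → f s t))) ⟩
  sum (λ t → sumFin m (λ s → f s t))       ≡⟨ sym (sumFin≡sum n _) ⟩
  sumFin n (λ t → sumFin m (λ s → f s t))  ∎
  where open ≡-Reasoning

sumFin-𝔼U-comm : ∀ n k (f : Fin n → Fin k → ℚ) →
  sumFin n (λ t → 𝔼U k (f t)) ≡ 𝔼U k (λ s → sumFin n (λ t → f t s))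
sumFin-𝔼U-comm n zero    f = sumFin-const-0 n
sumFin-𝔼U-comm n (suc k) f = begin
  sumFin n (λ t → sumFin (suc k) (f t) * u)          ≡⟨ sym (*-distribʳ-sumFin n u _) ⟩
  sumFin n (λ t → sumFin (suc k) (f t)) * u          ≡⟨ cong (_* u) (sumFin-comm n (suc k) f) ⟩
  sumFin (suc k) (λ s → sumFin n (λ t → f t s)) * u  ∎
  where
  u = + 1 / suc k
  open ≡-Reasoning

[]≔-inject₁-∷ʳ : ∀ {A : Set} {m} (i : Vec A m) (j : Fin m) (t s : A) →
  (i ∷ʳ t) [ inject₁ j ]≔ s ≡ (i [ j ]≔ s) ∷ʳ t
[]≔-inject₁-∷ʳ (x ∷ i) zero    t s = refl
[]≔-inject₁-∷ʳ (x ∷ i) (suc j) t s = cong (x ∷_) ([]≔-inject₁-∷ʳ i j t s)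

marginal-dispersed : ∀ m k ρ (D : Vec (Fin k) (suc m) → ℚ) →
  Dispersed k (suc m) ρ D → Dispersed k m ρ (marginal k m D)
marginal-dispersed m k ρ D disp j i = begin
  sumFin k (λ t → D (i ∷ʳ t))
    ≤⟨ sumFin-mono-≤ k (λ t → disp (inject₁ j) (i ∷ʳ t)) ⟩
  sumFin k (λ t → c * 𝔼U k (λ s → D ((i ∷ʳ t) [ inject₁ j ]≔ s)))
    ≡⟨ sumFin-cong k (λ t → cong (c *_) (𝔼U-cong k (λ s → cong D ([]≔-inject₁-∷ʳ i j t s)))) ⟩
  sumFin k (λ t → c * 𝔼U k (λ s → D ((i [ j ]≔ s) ∷ʳ t)))
    ≡⟨ sym (*-distribˡ-sumFin k c _) ⟩
  c * sumFin k (λ t → 𝔼U k (λ s → D ((i [ j ]≔ s) ∷ʳ t)))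
    ≡⟨ cong (c *_) (sumFin-𝔼U-comm k k _) ⟩
  c * 𝔼U k (λ s → marginal k m D (i [ j ]≔ s))  ∎
  where
  c = + ρ / 1
  open ≤-Reasoning

lemma5p3 : (m k ρ : ℕ) (D : Vec (Fin k) (suc m) → ℚ) →
    IsDistribution k (suc m) D →
    Dispersed k (suc m) ρ D →
    Dispersed k m ρ (marginal k m D)
lemma5p3 m k ρ D _ = marginal-dispersed m k ρ D
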